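{- Let $P$, $Q$, $R$ be MIAs with common input alphabet $I$ and common output alphabet $O$, such that $R$ has a state set disjoint from those of $P$ and of $Q$, and let $p\in P$, $q\in Q$, $r\in R$. If $p\sqsubseteq_{\mathrm{MIA}} q$, then $p\vee r\sqsubseteq_{\mathrm{MIA}} q\vee r$.
   Context: A dMTS is $(P,A,\longrightarrow_P,\dashrightarrow_P)$ with states $P$, alphabet $A$ not containing $\tau$, must-relation $\longrightarrow_P\subseteq P\times A\times(2^P\setminus\{\emptyset\})$, may-relation $\dashrightarrow_P\subseteq P\times(A\cup\{\tau\})\times P$, and syntactic consistency ($p\xrightarrow{a}P'$ implies $p\stackrel{a}{\dashrightarrow}p'$ for all $p'\in P'$). A Modal Interface Automaton (MIA) is $(P,I,O,\longrightarrow_P,\dashrightarrow_P)$ with $I,O$ disjoint such that $(P,I\cup O,\longrightarrow_P,\dashrightarrow_P)$ is a dMTS and for all $i\in I$: (a) $p\xrightarrow{i}P'$ and $p\xrightarrow{i}P''$ imply $P'=P''$; (b) $p\stackrel{i}{\dashrightarrow}p'$ implies $p\xrightarrow{i}P'$ for some $P'\ni p'$. Write $p\stackrel{a}{\dashrightarrow}$ if some may-$a$-transition leaves $p$. Weak may: $p\stackrel{\epsilon}{\Longrightarrow}p'$ iff $p(\stackrel{\tau}{\dashrightarrow})^*p'$; $p\stackrel{\alpha}{\Longrightarrow}p'$ iff $\exists p''.\,p\stackrel{\epsilon}{\Longrightarrow}p''\stackrel{\alpha}{\dashrightarrow}p'$; $\hat\tau=\epsilon$, $\hat a=a$. For MIAs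 $P,Q$ with the same $I,O$, $\mathcal R\subseteq P\times Q$ is a MIA-refinement relation if for all $(p,q)\in\mathcal R$: (i) $q\xrightarrow{a}Q'$ ($a\in I\cup O$) implies some $P'$ with $p\xrightarrow{a}P'$ and $\forall p'\in P'\,\exists q'\in Q'.\,(p',q')\in\mathcal R$; (ii) $p\stackrel{\alpha}{\dashrightarrow}p'$ with $\alpha\in O\cup\{\tau\}$ implies some $q'$ with $q\stackrel{\hat\alpha}{\Longrightarrow}q'$ and $(p',q')\in\mathcal R$. $p\sqsubseteq_{\mathrm{MIA}}q$ iff some such relation contains $(p,q)$. MIA-disjunction: for MIAs $P,Q$ with common $I,O$ and disjoint state sets, $P\vee Q$ has state set $\{p\vee q:p\in P,q\in Q\}\cup P\cup Q$, alphabets $I,O$, and the least must- and may-transition relations containing those of $P$ and $Q$ and satisfying: (Must) $p\vee q\xrightarrow{a}P'\cup Q'$ if $p\xrightarrow{a}_PP'$ and $q\xrightarrow{a}_QQ'$; (May1) $p\vee q\stackrel{\alpha}{\dashrightarrow}p'$ if $p\stackrel{\alpha}{\dashrightarrow}_Pp'$ and, in case $\alpha\in I$, also $q\stackrel{\alpha}{\dashrightarrow}_Q$; (May2) $p\vee q\stackrel{\alpha}{\dashrightarrow}q'$ if $q\stackrel{\alpha}{\dashrightarrow}_Qq'$ and, in case $\alpha\in I$, also $p\stackrel{\alpha}{\dashrightarrow}_P$. -}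

module Defs where

open import Data.Product using (Σ; ∃; ∃-syntax; _×_; _,_)
open import Data.Sum using (_⊎_; inj₁; inj₂)
open import Data.Empty using (⊥)
open import Data.Unit using (⊤)
open import Relation.Binary.Construct.Closure.ReflexiveTransitive using (Star)
open import Function.Bundles using (_⇔_)

-- Visible actions over disjoint input alphabet I and output alphabet O:
-- A = I ⊎ O  (disjointness of I and O is built in by the sum type).
Act : Set → Set → Set
Act I O = I ⊎ O

data Lab (I O : Set) : Set where
  act : Act I O → Lab I O
  τ   : Lab I O

Subset : Set → Set₁
Subset S = S → Set

record Modal (I O : Set) : Set₂ where
  field
    St   : Set
    must : St → Act I O → Subset St → Set₁
    may  : St → Lab I O → St → Set

-- dMTS conditions (nonempty must targets, syntactic consistency) plus the
-- MIA conditions (a) and (b) on inputs.  Set equality in (a) is extensional.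
record IsMIA {I O : Set} (M : Modal I O) : Set₁ where
  open Modal M
  field
    must-nonempty : ∀ {p a P'} → must p a P' → ∃[ p' ] P' p'
    consistency   : ∀ {p a P' p'} → must p a P' → P' p' → may p (act a) p'
    input-det     : ∀ {p i P' P''} → must p (inj₁ i) P' → must p (inj₁ i) P'' →
                    ∀ x → P' x ⇔ P'' x
    input-must    : ∀ {p i p'} → may p (act (inj₁ i)) p' →
                    ∃[ P' ] (must p (inj₁ i) P' × P' p')

record MIA (I O : Set) : Set₂ where
  field
    modal : Modal I O
    isMIA : IsMIA modal
  open Modal modal public

module _ {I O : Set} (M : Modal I O) where
  open Modal M

  τ-step : St → St → Set
  τ-step p p' = may p τ p'

  WeakEps : St → St → Set
  WeakEps = Star τ-step

  Weak : St → Lab I O → St → Set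
  Weak p α p' = ∃[ p'' ] (WeakEps p p'' × may p'' α p')

  WeakHat : St → Lab I O → St → Set
  WeakHat p τ       p' = WeakEps p p'
  WeakHat p (act a) p' = Weak p (act a) p'

data OutOrTau {I O : Set} : Lab I O → Set where
  out : (o : O) → OutOrTau (act (inj₂ o))
  tau : OutOrTau τ

module _ {I O : Set} (P Q : Modal I O) where
  private
    module P = Modal P
    module Q = Modal Q

  IsMIARefinement : (P.St → Q.St → Set) → Set₁
  IsMIARefinement R = ∀ p q → R p q →
      (∀ a Q' → Q.must q a Q' →
         ∃[ P' ] (P.must p a P' × (∀ p' → P' p' → ∃[ q' ] (Q' q' × R p' q'))))
    × (∀ α p' → OutOrTau α → P.may p α p' →
         ∃[ q' ] (WeakHat Q q α q' × R p' q'))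

  _⊑MIA_ : P.St → Q.St → Set₁
  p ⊑MIA q = ∃[ R ] (IsMIARefinement R × R p q)

-- MIA-disjunction.  States {p ∨ q} ∪ P ∪ Q, kept disjoint by tagging.
module _ {I O : Set} (P Q : Modal I O) where
  private
    module P = Modal P
    module Q = Modal Q

  data DSt : Set where
    _∨_ : P.St → Q.St → DSt
    inP : P.St → DSt
    inQ : Q.St → DSt

  liftP : Subset P.St → Subset DSt
  liftP P' (inP x) = P' x
  liftP P' _       = ⊥

  liftQ : Subset Q.St → Subset DSt
  liftQ Q' (inQ x) = Q' x
  liftQ Q' _       = ⊥

  unionPQ : Subset P.St → Subset Q.St → Subset DSt
  unionPQ P' Q' (inP x) = P' x
  unionPQ P' Q' (inQ x) = Q' x
  unionPQ P' Q' (_ ∨ _) = ⊥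

  InputGuard : (M : Modal I O) → Modal.St M → Lab I O → Set
  InputGuard M s (act (inj₁ i)) = ∃[ s' ] Modal.may M s (act (inj₁ i)) s'
  InputGuard M s (act (inj₂ o)) = ⊤
  InputGuard M s τ              = ⊤

  data DMust : DSt → Act I O → Subset DSt → Set₁ where
    mustP  : ∀ {p a P'} → P.must p a P' → DMust (inP p) a (liftP P')
    mustQ  : ∀ {q a Q'} → Q.must q a Q' → DMust (inQ q) a (liftQ Q')
    mustPQ : ∀ {p q a P' Q'} → P.must p a P' → Q.must q a Q' →
             DMust (p ∨ q) a (unionPQ P' Q')

  data DMay : DSt → Lab I O → DSt → Set where
    mayP : ∀ {p α p'} → P.may p α p' → DMay (inP p) α (inP p')
    mayQ : ∀ {q α q'} → Q.may q α q' → DMay (inQ q) α (inQ q')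
    may1 : ∀ {p q α p'} → P.may p α p' → InputGuard Q q α →
           DMay (p ∨ q) α (inP p')
    may2 : ∀ {p q α q'} → Q.may q α q' → InputGuard P p α →
           DMay (p ∨ q) α (inQ q')

  Disj : Modal I O
  Disj = record { St = DSt ; must = DMust ; may = DMay }

module Submission where

-- The witness relation relates p ∨ r to q ∨ r, the copies of P-states to copies of Q-states
-- (or to the disjunction state they came from), and each copy of an R-state to itself.
-- Must-transitions of q ∨ r are built from one of q and one of r, so the refinement p ⊑ q
-- supplies the matching must-transition of p. A may-step of p ∨ r into P is simulated by a
-- weak step of q into Q, which lifts to q ∨ r; a may-step into R is copied verbatim. Only
-- outputs and τ are simulated, so the input guards of (May1) and (May2) never matter.

open import Defs
open import Data.Product using (∃-syntax; _×_; _,_; proj₁; proj₂)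
open import Data.Unit using (tt)
open import Function using (id)
open import Relation.Binary.Construct.Closure.ReflexiveTransitive using (ε; _◅_; gmap)

may⇒weakHat : ∀ {I O} (M : Modal I O) {s α s'} → Modal.may M s α s' → WeakHat M s α s'
may⇒weakHat M {α = τ}     m = m ◅ ε
may⇒weakHat M {α = act a} m = _ , ε , m

outOrTau⇒inputGuard : ∀ {I O} (A B : Modal I O) {M : Modal I O} {s α} → OutOrTau α →
  InputGuard A B M s α
outOrTau⇒inputGuard _ _ (out o) = tt
outOrTau⇒inputGuard _ _ tau     = tt

module _ {I O : Set} (Q R : Modal I O) where
  private
    module Q = Modal Q
    QR = Disj Q R

  data LeftPart (q : Q.St) : DSt Q R → Set where
    inP-left : LeftPart q (inP q)
    ∨-left   : ∀ {r} → LeftPart q (q ∨ r)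

  inP-weakEps : ∀ {q q'} → WeakEps Q q q' → WeakEps QR (inP q) (inP q')
  inP-weakEps = gmap inP mayP

  inP-weakHat : ∀ {q α q'} → WeakHat Q q α q' → WeakHat QR (inP q) α (inP q')
  inP-weakHat {α = τ}     w             = inP-weakEps w
  inP-weakHat {α = act a} (_ , w , m) = _ , inP-weakEps w , mayP m

  leftPart-weakHat : ∀ {q t α q'} → LeftPart q t → OutOrTau α → WeakHat Q q α q' →
    ∃[ t' ] (WeakHat QR t α t' × LeftPart q' t')
  leftPart-weakHat inP-left _       w                   = _ , inP-weakHat w , inP-left
  leftPart-weakHat ∨-left   tau     ε                   = _ , ε , ∨-left
  leftPart-weakHat ∨-left   tau     (m ◅ w)             = _ , may1 m tt ◅ inP-weakEps w , inP-left
  leftPart-weakHat ∨-left   (out o) (_ , ε , m)       = _ , (_ , ε , may1 m tt) , inP-left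
  leftPart-weakHat ∨-left   (out o) (_ , m ◅ w , m') =
    _ , (_ , may1 m tt ◅ inP-weakEps w , mayP m') , inP-left

  leftPart-must : ∀ {q t a T'} → LeftPart q t → DMust Q R t a T' →
    ∃[ Q' ] (Q.must q a Q' × (∀ {x} → Q' x → T' (inP x)))
  leftPart-must inP-left (mustP m)    = _ , m , id
  leftPart-must ∨-left   (mustPQ m _) = _ , m , id

module DisjunctionRefinement {I O : Set} (P Q R : Modal I O)
  (Rel : Modal.St P → Modal.St Q → Set) (isRefinement : IsMIARefinement P Q Rel) where
  private
    module P = Modal P
    module Q = Modal Q
    PR = Disj P R
    QR = Disj Q R

  refine-must : ∀ {p q a Q'} → Rel p q → Q.must q a Q' →
    ∃[ P' ] (P.must p a P' × (∀ p' → P' p' → ∃[ q' ] (Q' q' × Rel p' q')))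
  refine-must pq m = proj₁ (isRefinement _ _ pq) _ _ m

  refine-may : ∀ {p q α p'} → Rel p q → OutOrTau α → P.may p α p' →
    ∃[ q' ] (WeakHat Q q α q' × Rel p' q')
  refine-may pq o m = proj₂ (isRefinement _ _ pq) _ _ o m

  data Lifted : DSt P R → DSt Q R → Set where
    both  : ∀ {p q r} → Rel p q → Lifted (p ∨ r) (q ∨ r)
    left  : ∀ {p q t} → Rel p q → LeftPart Q R q t → Lifted (inP p) t
    right : ∀ {r} → Lifted (inQ r) (inQ r)

  lifted-must : ∀ {s t} → Lifted s t → ∀ a T' → DMust Q R t a T' →
    ∃[ S' ] (DMust P R s a S' × (∀ s' → S' s' → ∃[ t' ] (T' t' × Lifted s' t')))
  lifted-must (both pq) a _ (mustPQ mQ mR) with refine-must pq mQ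
  ... | _ , mP , sim = _ , mustPQ mP mR , λ where
    (inP p') p'∈P' → let q' , q'∈Q' , p'q' = sim p' p'∈P' in inP q' , q'∈Q' , left p'q' inP-left
    (inQ r') r'∈R' → inQ r' , r'∈R' , right
    (_ ∨ _)  ()
  lifted-must (left pq lq) a T' m with leftPart-must Q R lq m
  ... | _ , mQ , Q'⊆T' with refine-must pq mQ
  ... | _ , mP , sim = _ , mustP mP , λ where
    (inP p') p'∈P' → let q' , q'∈Q' , p'q' = sim p' p'∈P' in inP q' , Q'⊆T' q'∈Q' , left p'q' inP-left
    (inQ _)  ()
    (_ ∨ _)  ()
  lifted-must right a _ (mustQ mR) = _ , mustQ mR , λ where
    (inQ r') r'∈R' → inQ r' , r'∈R' , right
    (inP _)  ()
    (_ ∨ _)  ()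

  left-may : ∀ {p q t α p'} → Rel p q → LeftPart Q R q t → OutOrTau α → P.may p α p' →
    ∃[ t' ] (WeakHat QR t α t' × Lifted (inP p') t')
  left-may pq lq o m with refine-may pq o m
  ... | _ , w , p'q' with leftPart-weakHat Q R lq o w
  ... | t' , w' , lq' = t' , w' , left p'q' lq'

  lifted-may : ∀ {s t} → Lifted s t → ∀ α s' → OutOrTau α → DMay P R s α s' →
    ∃[ t' ] (WeakHat QR t α t' × Lifted s' t')
  lifted-may (both pq)    _ _ o (may1 m _) = left-may pq ∨-left o m
  lifted-may (both pq)    _ _ o (may2 m _) =
    _ , may⇒weakHat QR (may2 m (outOrTau⇒inputGuard Q R o)) , right
  lifted-may (left pq lq) _ _ o (mayP m)   = left-may pq lq o m
  lifted-may right        _ _ o (mayQ m)   = _ , may⇒weakHat QR (mayQ m) , right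

  lifted-isRefinement : IsMIARefinement PR QR Lifted
  lifted-isRefinement _ _ st = lifted-must st , lifted-may st

corollary4p11 : {I O : Set} (P Q R : MIA I O) →
    (p : MIA.St P) (q : MIA.St Q) (r : MIA.St R) →
    _⊑MIA_ (MIA.modal P) (MIA.modal Q) p q →
    _⊑MIA_ (Disj (MIA.modal P) (MIA.modal R)) (Disj (MIA.modal Q) (MIA.modal R)) (p ∨ r) (q ∨ r)
corollary4p11 P Q R p q r (Rel , isRefinement , pq) =
  Lifted , lifted-isRefinement , both pq
  where open DisjunctionRefinement (MIA.modal P) (MIA.modal Q) (MIA.modal R) Rel isRefinement
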